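{- Assume $|A|\ge 2$. Then for all closed terms $P$ and $Q$ over $\Sigma_{CP}(A)$: if $P=_{rp}Q$ then $\mathrm{CP}_{rp}\vdash P=Q$.
   Context: Fix a finite non-empty set $A$ of atomic propositions. Closed terms are built from $T$, $F$, $a\in A$ by conditional composition $P\triangleleft Q\triangleright R$. $\mathrm{CP}_{rp}$ consists of (CP1) $x\triangleleft T\triangleright y=x$, (CP2) $x\triangleleft F\triangleright y=y$, (CP3) $T\triangleleft x\triangleright F=x$, (CP4) $x\triangleleft(y\triangleleft z\triangleright u)\triangleright v=(x\triangleleft y\triangleright v)\triangleleft z\triangleright(x\triangleleft u\triangleright v)$, and for every $a\in A$: (CPrp1) $(x\triangleleft a\triangleright y)\triangleleft a\triangleright z=(x\triangleleft a\triangleright x)\triangleleft a\triangleright z$, (CPrp2) $x\triangleleft a\triangleright(y\triangleleft a\triangleright z)=x\triangleleft a\triangleright(z\triangleleft a\triangleright z)$; $\vdash$ is equational derivability. A reactive valuation algebra (RVA) is a set $RV$ with elements $T_{RV},F_{RV}$ and for each $a\in A$ functions $y_a:RV\to\{T,F\}$, $\partial_a:RV\to RV$ with $y_a(T_{RV})=T$, $y_a(F_{RV})=F$, $\partial_a(T_{RV})=T_{RV}$, $\partial_a(F_{RV})=F_{RV}$. For closed $P$ and $H\in RV$: $T/H=T$, $F/H=F$, $a/H=y_a(H)$, $\partial_T(H)=\partial_F(H)=H$; $(P\triangleleft Q\triangleright R)/H=P/\partial_Q(H)$ and $\partial_{P\triangleleft Q\triangleright R}(H)=\partial_P(\partial_Q(H))$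 if $Q/H=T$, and $R/\partial_Q(H)$ resp. $\partial_R(\partial_Q(H))$ if $Q/H=F$. The variety $rp$ is the class of RVAs with $y_a(\partial_a(H))=y_a(H)$ for all $a$, $H$. $P\equiv_{rp}Q$ means $P/H=Q/H$ for all RVAs in $rp$ and all $H$; $=_{rp}$ is the largest congruence (w.r.t. conditional composition) on closed terms contained in $\equiv_{rp}$. -}

module Defs where

open import Level using (Level; suc; zero)
open import Data.Nat using (ℕ)
open import Data.Fin using (Fin)
open import Data.Bool using (Bool; true; false; if_then_else_)
open import Data.Product using (Σ; _×_)
open import Relation.Binary.PropositionalEquality using (_≡_)

-- The finite set A of atomic propositions is represented as Fin n.

module _ (n : ℕ) where

  data CTerm : Set where
    T F  : CTerm
    atom : Fin n → CTerm
    _◁_▷_ : CTerm → CTerm → CTerm → CTerm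

  data OTerm : Set where
    var  : ℕ → OTerm
    T F  : OTerm
    atom : Fin n → OTerm
    _◁_▷_ : OTerm → OTerm → OTerm → OTerm

module _ {n : ℕ} where

  embed : CTerm n → OTerm n
  embed T = T
  embed F = F
  embed (atom a) = atom a
  embed (P ◁ Q ▷ R) = embed P ◁ embed Q ▷ embed R

  subst : (ℕ → OTerm n) → OTerm n → OTerm n
  subst σ (var i) = σ i
  subst σ T = T
  subst σ F = F
  subst σ (atom a) = atom a
  subst σ (P ◁ Q ▷ R) = subst σ P ◁ subst σ Q ▷ subst σ R

  private
    x y z u v : OTerm n
    x = var 0
    y = var 1
    z = var 2
    u = var 3
    v = var 4

  data CPrp-Axiom : OTerm n → OTerm n → Set where
    CP1 : CPrp-Axiom (x ◁ T ▷ y) x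
    CP2 : CPrp-Axiom (x ◁ F ▷ y) y
    CP3 : CPrp-Axiom (T ◁ x ▷ F) x
    CP4 : CPrp-Axiom (x ◁ (y ◁ z ▷ u) ▷ v) ((x ◁ y ▷ v) ◁ z ▷ (x ◁ u ▷ v))
    CPrp1 : (a : Fin n) →
      CPrp-Axiom ((x ◁ atom a ▷ y) ◁ atom a ▷ z) ((x ◁ atom a ▷ x) ◁ atom a ▷ z)
    CPrp2 : (a : Fin n) →
      CPrp-Axiom (x ◁ atom a ▷ (y ◁ atom a ▷ z)) (x ◁ atom a ▷ (z ◁ atom a ▷ z))

  data CPrp⊢_≈_ : OTerm n → OTerm n → Set where
    ax    : ∀ {l r} → CPrp-Axiom l r → (σ : ℕ → OTerm n) → CPrp⊢ subst σ l ≈ subst σ r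
    refl  : ∀ {s} → CPrp⊢ s ≈ s
    sym   : ∀ {s t} → CPrp⊢ s ≈ t → CPrp⊢ t ≈ s
    trans : ∀ {s t w} → CPrp⊢ s ≈ t → CPrp⊢ t ≈ w → CPrp⊢ s ≈ w
    cong  : ∀ {s s' t t' w w'} → CPrp⊢ s ≈ s' → CPrp⊢ t ≈ t' → CPrp⊢ w ≈ w' →
            CPrp⊢ (s ◁ t ▷ w) ≈ (s' ◁ t' ▷ w')

-- Reactive valuation algebras ({T,F} represented by Bool, T = true, F = false)
record RVA (n : ℕ) : Set₁ where
  field
    RV   : Set
    T-RV : RV
    F-RV : RV
    y    : Fin n → RV → Bool
    ∂    : Fin n → RV → RV
    y-T  : ∀ a → y a T-RV ≡ true
    y-F  : ∀ a → y a F-RV ≡ false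
    ∂-T  : ∀ a → ∂ a T-RV ≡ T-RV
    ∂-F  : ∀ a → ∂ a F-RV ≡ F-RV

module _ {n : ℕ} (𝕍 : RVA n) where
  open RVA 𝕍

  mutual
    _/_ : CTerm n → RV → Bool
    T / H = true
    F / H = false
    atom a / H = y a H
    (P ◁ Q ▷ R) / H = if Q / H then P / ∂[ Q ] H else R / ∂[ Q ] H

    ∂[_] : CTerm n → RV → RV
    ∂[ T ] H = H
    ∂[ F ] H = H
    ∂[ atom a ] H = ∂ a H
    ∂[ P ◁ Q ▷ R ] H = if Q / H then ∂[ P ] (∂[ Q ] H) else ∂[ R ] (∂[ Q ] H)

InRp : ∀ {n} → RVA n → Set
InRp 𝕍 = ∀ a H → y a (∂ a H) ≡ y a H
  where open RVA 𝕍

_≡rp_ : ∀ {n} → CTerm n → CTerm n → Set₁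
P ≡rp Q = ∀ (𝕍 : RVA _) → InRp 𝕍 → ∀ H → _/_ 𝕍 P H ≡ _/_ 𝕍 Q H

record IsCongruence {n : ℕ} (R : CTerm n → CTerm n → Set₁) : Set₁ where
  field
    reflexive  : ∀ {P} → R P P
    symmetric  : ∀ {P Q} → R P Q → R Q P
    transitive : ∀ {P Q S} → R P Q → R Q S → R P S
    compatible : ∀ {P P' Q Q' S S'} → R P P' → R Q Q' → R S S' →
                 R (P ◁ Q ▷ S) (P' ◁ Q' ▷ S')

-- P =_rp Q : related by the largest congruence contained in ≡_rp,
-- i.e. related by some congruence contained in ≡_rp.
_=rp_ : ∀ {n} → CTerm n → CTerm n → Set₂
_=rp_ {n} P Q = Σ (CTerm n → CTerm n → Set₁) λ R →
  IsCongruence R × (∀ {P' Q'} → R P' Q' → P' ≡rp Q') × R P Q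

-- Soundness of CP_rp is routine. Conversely, CP1-CP4 flatten every closed term into a
-- decision tree over the atoms, and CPrp1/2 say that a test repeating the test just
-- made is decided as before; so every tree is provably equal to an rp-normal one, in
-- which such a repeated test has two equal branches. Distinct normal forms are told
-- apart in a reactive valuation algebra whose states are histories of answered tests,
-- replied to by an oracle that must only repeat the answer to the test just made.
-- Steering the oracle into the branch where the trees differ, the two runs end with
-- different replies or in different histories; in the latter case, as |A| ≥ 2, a test
-- of an atom other than the last one tested can be answered differently after the
-- two histories. Since =rp is a congruence, P =rp Q makes P, Q and also b ◁ P ▷ b,
-- b ◁ Q ▷ b reply alike, so P and Q have the same normal form.
module Submission where

open import Defs
open import Data.Nat using (ℕ; _≤_; _<_; suc; s≤s; z≤n)
open import Data.Nat.Properties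
  using (≤-refl; ≤-trans; <-≤-trans; <-irrefl; ≤-total; n≤1+n)
open import Data.Fin using (Fin; zero; suc; _≟_)
open import Data.Bool using (Bool; true; false; if_then_else_; not)
open import Data.Bool.Properties using (if-eta; not-¬) renaming (_≟_ to _≟ᵇ_)
open import Data.Maybe using (Maybe; just; nothing)
open import Data.Maybe.Properties using (just-injective)
open import Data.Product using (∃-syntax; _×_; _,_; proj₁; proj₂)
open import Data.Product.Properties using () renaming (≡-dec to ×-≡-dec)
open import Data.Sum using (_⊎_; inj₁; inj₂)
open import Data.List using (List; []; _∷_; _++_; _∷ʳ_; length; head; [_])
open import Data.List.Properties
  using (++-cancelʳ; ∷ʳ-injectiveʳ; ∷ʳ-++; length-++-≤ʳ)
  renaming (≡-dec to List-≡-dec)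
open import Data.Empty using (⊥-elim)
open import Function using (_∘_)
open import Relation.Nullary using (Dec; does; yes; no)
open import Relation.Binary.PropositionalEquality as Eq using (_≡_; _≢_; _≗_; refl)
open Eq.≡-Reasoning

++-∷-cancelʳ : ∀ {A : Set} (X Y : List A) {p q : A} h →
               X ++ p ∷ h ≡ Y ++ q ∷ h → p ≡ q
++-∷-cancelʳ X Y {p} {q} h e =
  ∷ʳ-injectiveʳ X Y (++-cancelʳ h (X ∷ʳ p) (Y ∷ʳ q) (begin
  (X ∷ʳ p) ++ h  ≡⟨ ∷ʳ-++ X p h ⟩
  X ++ p ∷ h     ≡⟨ e ⟩
  Y ++ q ∷ h     ≡⟨ ∷ʳ-++ Y q h ⟨
  (Y ∷ʳ q) ++ h  ∎))

module Soundness {n : ℕ} (𝕍 : RVA n) where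
  open RVA 𝕍

  Reaction : Set
  Reaction = RV → Bool × RV

  reaction : CTerm n → Reaction
  reaction P H = _/_ 𝕍 P H , ∂[_] 𝕍 P H

  branchOn : Bool × RV → Reaction → Reaction → Bool × RV
  branchOn (true , H) p r = p H
  branchOn (false , H) p r = r H

  ⟦_⟧ : OTerm n → (ℕ → Reaction) → Reaction
  ⟦ var i ⟧ ρ = ρ i
  ⟦ T ⟧ ρ H = true , H
  ⟦ F ⟧ ρ H = false , H
  ⟦ atom a ⟧ ρ H = y a H , ∂ a H
  ⟦ P ◁ Q ▷ R ⟧ ρ H = branchOn (⟦ Q ⟧ ρ H) (⟦ P ⟧ ρ) (⟦ R ⟧ ρ)

  ⟦subst⟧ : ∀ σ t ρ → ⟦ subst σ t ⟧ ρ ≗ ⟦ t ⟧ (λ i → ⟦ σ i ⟧ ρ)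
  ⟦subst⟧ σ (var i) ρ H = refl
  ⟦subst⟧ σ T ρ H = refl
  ⟦subst⟧ σ F ρ H = refl
  ⟦subst⟧ σ (atom a) ρ H = refl
  ⟦subst⟧ σ (P ◁ Q ▷ R) ρ H
    rewrite ⟦subst⟧ σ Q ρ H with ⟦ Q ⟧ (λ i → ⟦ σ i ⟧ ρ) H
  ... | true , H′ = ⟦subst⟧ σ P ρ H′
  ... | false , H′ = ⟦subst⟧ σ R ρ H′

  ⟦embed⟧ : ∀ P ρ → ⟦ embed P ⟧ ρ ≗ reaction P
  ⟦embed⟧ T ρ H = refl
  ⟦embed⟧ F ρ H = refl
  ⟦embed⟧ (atom a) ρ H = refl
  ⟦embed⟧ (P ◁ Q ▷ R) ρ H rewrite ⟦embed⟧ Q ρ H with _/_ 𝕍 Q H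
  ... | true = ⟦embed⟧ P ρ (∂[_] 𝕍 Q H)
  ... | false = ⟦embed⟧ R ρ (∂[_] 𝕍 Q H)

  module _ (rp : InRp 𝕍) where

    axiom-sound : ∀ {l r} → CPrp-Axiom l r → ∀ ρ → ⟦ l ⟧ ρ ≗ ⟦ r ⟧ ρ
    axiom-sound CP1 ρ H = refl
    axiom-sound CP2 ρ H = refl
    axiom-sound CP3 ρ H with ρ 0 H
    ... | true , _ = refl
    ... | false , _ = refl
    axiom-sound CP4 ρ H with ρ 2 H
    ... | true , _ = refl
    ... | false , _ = refl
    axiom-sound (CPrp1 a) ρ H with y a H in eq
    ... | true rewrite Eq.trans (rp a H) eq = refl
    ... | false = refl
    axiom-sound (CPrp2 a) ρ H with y a H in eq
    ... | true = refl
    ... | false rewrite Eq.trans (rp a H) eq = refl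

    sound : ∀ {s t} → CPrp⊢ s ≈ t → ∀ ρ → ⟦ s ⟧ ρ ≗ ⟦ t ⟧ ρ
    sound (ax {l} {r} α σ) ρ H = begin
      ⟦ subst σ l ⟧ ρ H              ≡⟨ ⟦subst⟧ σ l ρ H ⟩
      ⟦ l ⟧ (λ i → ⟦ σ i ⟧ ρ) H      ≡⟨ axiom-sound α _ H ⟩
      ⟦ r ⟧ (λ i → ⟦ σ i ⟧ ρ) H      ≡⟨ ⟦subst⟧ σ r ρ H ⟨
      ⟦ subst σ r ⟧ ρ H              ∎
    sound refl ρ H = refl
    sound (sym d) ρ H = Eq.sym (sound d ρ H)
    sound (trans d e) ρ H = Eq.trans (sound d ρ H) (sound e ρ H)
    sound (cong {t' = t'} d e k) ρ H rewrite sound e ρ H with ⟦ t' ⟧ ρ H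
    ... | true , H′ = sound d ρ H′
    ... | false , H′ = sound k ρ H′

    sound-closed : ∀ {P Q} → CPrp⊢ embed P ≈ embed Q → reaction P ≗ reaction Q
    sound-closed {P} {Q} d H = begin
      reaction P H           ≡⟨ ⟦embed⟧ P ρ H ⟨
      ⟦ embed P ⟧ ρ H        ≡⟨ sound d ρ H ⟩
      ⟦ embed Q ⟧ ρ H        ≡⟨ ⟦embed⟧ Q ρ H ⟩
      reaction Q H           ∎
      where
        ρ : ℕ → Reaction
        ρ _ H = true , H

module _ {n : ℕ} where

  private variable
    s t : OTerm n
    a : Fin n
    v : Bool

  cp1 : (s t : OTerm n) → CPrp⊢ (s ◁ T ▷ t) ≈ s
  cp1 s t = ax CP1 λ { 0 → s ; _ → t }

  cp2 : (s t : OTerm n) → CPrp⊢ (s ◁ F ▷ t) ≈ t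
  cp2 s t = ax CP2 λ { 0 → s ; _ → t }

  cp3 : (s : OTerm n) → CPrp⊢ (T ◁ s ▷ F) ≈ s
  cp3 s = ax CP3 λ _ → s

  cp4 : (s t u w z : OTerm n) →
    CPrp⊢ (s ◁ (t ◁ u ▷ w) ▷ z) ≈ ((s ◁ t ▷ z) ◁ u ▷ (s ◁ w ▷ z))
  cp4 s t u w z = ax CP4 λ { 0 → s ; 1 → t ; 2 → u ; 3 → w ; _ → z }

  cprp1 : ∀ a (s t u : OTerm n) →
    CPrp⊢ ((s ◁ atom a ▷ t) ◁ atom a ▷ u) ≈ ((s ◁ atom a ▷ s) ◁ atom a ▷ u)
  cprp1 a s t u = ax (CPrp1 a) λ { 0 → s ; 1 → t ; _ → u }

  cprp2 : ∀ a (s t u : OTerm n) →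
    CPrp⊢ (s ◁ atom a ▷ (t ◁ atom a ▷ u)) ≈ (s ◁ atom a ▷ (u ◁ atom a ▷ u))
  cprp2 a s t u = ax (CPrp2 a) λ { 0 → s ; 1 → t ; _ → u }

  data BF : Set where
    leaf : Bool → BF
    node : Fin n → BF → BF → BF

  private variable
    x y : BF

  toTerm : BF → CTerm n
  toTerm (leaf true) = T
  toTerm (leaf false) = F
  toTerm (node a x y) = toTerm x ◁ atom a ▷ toTerm y

  ⌜_⌝ : BF → OTerm n
  ⌜ x ⌝ = embed (toTerm x)

  _◁ᵇ_▷ᵇ_ : BF → BF → BF → BF
  x ◁ᵇ leaf v ▷ᵇ y = if v then x else y
  x ◁ᵇ node a q r ▷ᵇ y = node a (x ◁ᵇ q ▷ᵇ y) (x ◁ᵇ r ▷ᵇ y)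

  ◁ᵇ▷ᵇ-≈ : ∀ x q y →
    CPrp⊢ (⌜ x ⌝ ◁ ⌜ q ⌝ ▷ ⌜ y ⌝) ≈ ⌜ x ◁ᵇ q ▷ᵇ y ⌝
  ◁ᵇ▷ᵇ-≈ x (leaf true) y = cp1 ⌜ x ⌝ ⌜ y ⌝
  ◁ᵇ▷ᵇ-≈ x (leaf false) y = cp2 ⌜ x ⌝ ⌜ y ⌝
  ◁ᵇ▷ᵇ-≈ x (node a q r) y =
    trans (cp4 ⌜ x ⌝ ⌜ q ⌝ (atom a) ⌜ r ⌝ ⌜ y ⌝)
          (cong (◁ᵇ▷ᵇ-≈ x q y) refl (◁ᵇ▷ᵇ-≈ x r y))

  basic : CTerm n → BF
  basic T = leaf true
  basic F = leaf false
  basic (atom a) = node a (leaf true) (leaf false)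
  basic (P ◁ Q ▷ R) = basic P ◁ᵇ basic Q ▷ᵇ basic R

  basic-≈ : ∀ P → CPrp⊢ embed P ≈ ⌜ basic P ⌝
  basic-≈ T = refl
  basic-≈ F = refl
  basic-≈ (atom a) = sym (cp3 (atom a))
  basic-≈ (P ◁ Q ▷ R) =
    trans (cong (basic-≈ P) (basic-≈ Q) (basic-≈ R))
          (◁ᵇ▷ᵇ-≈ (basic P) (basic Q) (basic R))

  LastTest : Set
  LastTest = Maybe (Fin n × Bool)

  private variable
    c : LastTest

  inContext : LastTest → OTerm n → OTerm n → OTerm n
  inContext nothing z s = s
  inContext (just (a , true)) z s = s ◁ atom a ▷ z
  inContext (just (a , false)) z s = z ◁ atom a ▷ s

  _⊢_≈_ : LastTest → OTerm n → OTerm n → Set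
  c ⊢ s ≈ t = ∀ z → CPrp⊢ inContext c z s ≈ inContext c z t

  inContext-cong : ∀ c (z : OTerm n) →
    CPrp⊢ s ≈ t → CPrp⊢ inContext c z s ≈ inContext c z t
  inContext-cong nothing z d = d
  inContext-cong (just (a , true)) z d = cong d refl refl
  inContext-cong (just (a , false)) z d = cong refl refl d

  repeated-test : ∀ (a : Fin n) v s t →
    just (a , v) ⊢ inContext (just (a , v)) t s ≈ inContext (just (a , v)) s s
  repeated-test a true s t z = cprp1 a s t z
  repeated-test a false s t z = cprp2 a z t s

  collapse : just (a , v) ⊢ s ≈ t → ∀ u →
    just (a , v) ⊢ inContext (just (a , v)) u s ≈ inContext (just (a , v)) t t
  collapse {a} {v} {s} {t} s≈t u z =
    trans (repeated-test a v s u z)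
      (trans (inContext-cong (just (a , v)) z (s≈t s)) (repeated-test a v t s z))

  mutual
    data Normal : LastTest → BF → Set where
      leaf : Normal c (leaf v)
      node : NormalNode c a x y → Normal c (node a x y)

    data NormalNode : LastTest → Fin n → BF → BF → Set where
      repeated : Normal (just (a , v)) x → NormalNode (just (a , v)) a x x
      fresh : (∀ v → c ≢ just (a , v)) →
              Normal (just (a , true)) x → Normal (just (a , false)) y → NormalNode c a x y

  testedLast : ∀ (c : LastTest) (a : Fin n) →
    (∃[ v ] c ≡ just (a , v)) ⊎ (∀ v → c ≢ just (a , v))
  testedLast nothing a = inj₂ λ _ ()
  testedLast (just (b , v)) a with b ≟ a
  ... | yes refl = inj₁ (v , refl)
  ... | no b≢a = inj₂ λ { _ refl → b≢a refl }

  normalise : ∀ c x → ∃[ N ] Normal c N × c ⊢ ⌜ x ⌝ ≈ ⌜ N ⌝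
  normalise c (leaf v) = leaf v , leaf , λ _ → refl
  normalise c (node a x y) with testedLast c a
  normalise c (node a x y) | inj₂ new
    with normalise (just (a , true)) x | normalise (just (a , false)) y
  ... | N , nN , x≈N | M , nM , y≈M =
    node a N M , node (fresh new nN nM) ,
    λ z → inContext-cong c z (trans (x≈N ⌜ y ⌝) (y≈M ⌜ N ⌝))
  normalise .(just (a , true)) (node a x y) | inj₁ (true , refl)
    with normalise (just (a , true)) x
  ... | N , nN , x≈N = node a N N , node (repeated nN) , collapse {v = true} x≈N ⌜ y ⌝
  normalise .(just (a , false)) (node a x y) | inj₁ (false , refl)
    with normalise (just (a , false)) y
  ... | M , nM , y≈M = node a M M , node (repeated nM) , collapse {v = false} y≈M ⌜ x ⌝

  normalForm : ∀ P → ∃[ N ] Normal nothing N × CPrp⊢ embed P ≈ ⌜ N ⌝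
  normalForm P with normalise nothing (basic P)
  ... | N , nN , P≈N = N , nN , trans (basic-≈ P) (P≈N T)

module _ {n : ℕ} where

  History : Set
  History = List (Fin n × Bool)

  Oracle : Set
  Oracle = History → Fin n → Bool

  private variable
    c : LastTest
    f f′ : Oracle
    g h : History
    a b : Fin n
    v : Bool
    x y x′ y′ N M : BF

  _≟ʰ_ : (g h : History) → Dec (g ≡ h)
  _≟ʰ_ = List-≡-dec (×-≡-dec _≟_ _≟ᵇ_)

  -- Histories list the most recent test first.
  reply : Oracle → History → Fin n → Bool
  reply f [] b = f [] b
  reply f h@((a , v) ∷ _) b = if does (a ≟ b) then v else f h b

  reply-cong : ∀ h → f′ h ≡ f h → reply f′ h ≗ reply f h
  reply-cong [] e b = Eq.cong-app e b
  reply-cong ((a , v) ∷ _) e b = Eq.cong (if does (a ≟ b) then v else_) (Eq.cong-app e b)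

  reply-last : ∀ f h → head h ≡ just (a , v) → reply f h a ≡ v
  reply-last f ((a , v) ∷ _) refl with a ≟ a
  ... | yes _ = refl
  ... | no a≢a = ⊥-elim (a≢a refl)

  reply-untested : ∀ f (t : History) → a ≢ b →
    reply f ((a , v) ∷ t) b ≡ f ((a , v) ∷ t) b
  reply-untested {a} {b} f t a≢b with a ≟ b
  ... | yes a≡b = ⊥-elim (a≢b a≡b)
  ... | no _ = refl

  data State : Set where
    true-state false-state : State
    after : History → State

  answer : Oracle → Fin n → State → Bool
  answer f a true-state = true
  answer f a false-state = false
  answer f a (after h) = reply f h a

  ask : Oracle → Fin n → State → State
  ask f a true-state = true-state
  ask f a false-state = false-state
  ask f a (after h) = after ((a , reply f h a) ∷ h)

  historyRVA : Oracle → RVA n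
  historyRVA f = record
    { RV = State ; T-RV = true-state ; F-RV = false-state ; y = answer f ; ∂ = ask f
    ; y-T = λ _ → refl ; y-F = λ _ → refl ; ∂-T = λ _ → refl ; ∂-F = λ _ → refl }

  historyRVA-rp : ∀ f → InRp (historyRVA f)
  historyRVA-rp f a true-state = refl
  historyRVA-rp f a false-state = refl
  historyRVA-rp f a (after h) = reply-last f ((a , reply f h a) ∷ h) refl

  mutual
    run : Oracle → BF → History → Bool × History
    run f (leaf v) h = v , h
    run f (node a x y) h = continue f a x y h (reply f h a)

    continue : Oracle → Fin n → BF → BF → History → Bool → Bool × History
    continue f a x y h true = run f x ((a , true) ∷ h)
    continue f a x y h false = run f y ((a , false) ∷ h)

  final : Oracle → BF → History → History
  final f N h = proj₂ (run f N h)

  continue-branch : ∀ v → continue f a x y h v ≡ run f (if v then x else y) ((a , v) ∷ h)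
  continue-branch true = refl
  continue-branch false = refl

  run-sound : ∀ f N h →
    Soundness.reaction (historyRVA f) (toTerm N) (after h)
      ≡ (proj₁ (run f N h) , after (final f N h))
  run-sound f (leaf true) h = refl
  run-sound f (leaf false) h = refl
  run-sound f (node a x y) h with reply f h a
  ... | true = run-sound f x ((a , true) ∷ h)
  ... | false = run-sound f y ((a , false) ∷ h)

  mutual
    final-extends : ∀ f N h → ∃[ X ] final f N h ≡ X ++ h
    final-extends f (leaf v) h = [] , refl
    final-extends f (node a x y) h with final-node f a x y h
    ... | X , e = X ++ [ _ ] , Eq.trans e (Eq.sym (∷ʳ-++ X _ h))

    final-node : ∀ f a x y h → ∃[ X ] final f (node a x y) h ≡ X ++ (a , reply f h a) ∷ h
    final-node f a x y h with reply f h a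
    ... | true = final-extends f x ((a , true) ∷ h)
    ... | false = final-extends f y ((a , false) ∷ h)

  final-longer : ∀ f N h → length h ≤ length (final f N h)
  final-longer f N h with final-extends f N h
  ... | X , e rewrite e = length-++-≤ʳ h {X}

  node-longer : ∀ f a x y h → length h < length (final f (node a x y) h)
  node-longer f a x y h with final-node f a x y h
  ... | X , e rewrite e = length-++-≤ʳ (_ ∷ h) {X}

  shorter-≢ : length g < length h → g ≢ h
  shorter-≢ g<h refl = <-irrefl refl g<h

  AgreeBetween : Oracle → Oracle → ℕ → ℕ → Set
  AgreeBetween f f′ lo hi = ∀ g → lo ≤ length g → length g < hi → f′ g ≡ f g

  mutual
    frame : ∀ f f′ N h → AgreeBetween f f′ (length h) (length (final f N h)) →
            run f′ N h ≡ run f N h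
    frame f f′ (leaf v) h agree = refl
    frame f f′ (node a x y) h agree = begin
      continue f′ a x y h (reply f′ h a)
        ≡⟨ Eq.cong (continue f′ a x y h)
             (reply-cong h (agree h ≤-refl (node-longer f a x y h)) a) ⟩
      continue f′ a x y h (reply f h a)
        ≡⟨ frame-continue f f′ a x y h (reply f h a) agree ⟩
      continue f a x y h (reply f h a) ∎

    frame-continue : ∀ f f′ a x y h v →
      AgreeBetween f f′ (length h) (length (proj₂ (continue f a x y h v))) →
      continue f′ a x y h v ≡ continue f a x y h v
    frame-continue f f′ a x y h true agree =
      frame f f′ x ((a , true) ∷ h) λ g → agree g ∘ ≤-trans (n≤1+n _)
    frame-continue f f′ a x y h false agree =
      frame f f′ y ((a , false) ∷ h) λ g → agree g ∘ ≤-trans (n≤1+n _)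

  override : Oracle → History → (Fin n → Bool) → Oracle
  override f h φ g = if does (g ≟ʰ h) then φ else f g

  override-at : ∀ (f : Oracle) h φ → override f h φ h ≡ φ
  override-at f h φ with h ≟ʰ h
  ... | yes _ = refl
  ... | no h≢h = ⊥-elim (h≢h refl)

  override-elsewhere : ∀ (f : Oracle) φ → g ≢ h → override f h φ g ≡ f g
  override-elsewhere {g} {h} f φ g≢h with g ≟ʰ h
  ... | yes g≡h = ⊥-elim (g≢h g≡h)
  ... | no _ = refl

  -- Answering a with v at h respects rp.
  Admissible : History → Fin n → Bool → Set
  Admissible h a v = ∀ w → head h ≡ just (a , w) → w ≡ v

  reply-override : ∀ f h → Admissible h a v → reply (override f h λ _ → v) h a ≡ v
  reply-override {a} {v} f [] _ = Eq.cong-app (override-at f [] λ _ → v) a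
  reply-override {a} {v} f h@((b , w) ∷ _) admissible with b ≟ a
  ... | yes refl = admissible w refl
  ... | no _ = Eq.cong-app (override-at f h λ _ → v) a

  run-override-node : ∀ f h a v x y → Admissible h a v →
    run (override f h λ _ → v) (node a x y) h ≡ run f (if v then x else y) ((a , v) ∷ h)
  run-override-node f h a v x y admissible = begin
    continue steered a x y h (reply steered h a)
      ≡⟨ Eq.cong (continue steered a x y h) (reply-override f h admissible) ⟩
    continue steered a x y h v
      ≡⟨ continue-branch v ⟩
    run steered chosen ((a , v) ∷ h)
      ≡⟨ frame f steered chosen ((a , v) ∷ h) agree ⟩
    run f chosen ((a , v) ∷ h) ∎
    where
      steered : Oracle
      steered = override f h λ _ → v
      chosen : BF
      chosen = if v then x else y
      agree : AgreeBetween f steered (suc (length h)) (length (final f chosen ((a , v) ∷ h)))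
      agree g h<g _ = override-elsewhere f _ (shorter-≢ h<g ∘ Eq.sym)

  observe : Oracle → BF → History → Maybe (Fin n) → Bool
  observe f N h nothing = proj₁ (run f N h)
  observe f N h (just b) = reply f (final f N h) b

  Separable : BF → BF → History → Set
  Separable N M h = ∃[ f ] ∃[ o ] observe f N h o ≢ observe f M h o

  separable-sym : Separable N M h → Separable M N h
  separable-sym (f , o , differ) = f , o , differ ∘ Eq.sym

  observe-override-node : ∀ f h a v x y → Admissible h a v →
    observe (override f h λ _ → v) (node a x y) h
      ≗ observe f (if v then x else y) ((a , v) ∷ h)
  observe-override-node f h a v x y admissible nothing =
    Eq.cong proj₁ (run-override-node f h a v x y admissible)
  observe-override-node f h a v x y admissible (just b) = begin
    reply steered (final steered (node a x y) h) b
      ≡⟨ Eq.cong (λ r → reply steered (proj₂ r) b)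
           (run-override-node f h a v x y admissible) ⟩
    reply steered (final f chosen ((a , v) ∷ h)) b
      ≡⟨ reply-cong (final f chosen ((a , v) ∷ h)) (override-elsewhere f _ final≢h) b ⟩
    reply f (final f chosen ((a , v) ∷ h)) b ∎
    where
      steered : Oracle
      steered = override f h λ _ → v
      chosen : BF
      chosen = if v then x else y
      final≢h : final f chosen ((a , v) ∷ h) ≢ h
      final≢h = shorter-≢ (final-longer f chosen ((a , v) ∷ h)) ∘ Eq.sym

  separable-node : Admissible h a v →
    Separable (if v then x else y) (if v then x′ else y′) ((a , v) ∷ h) →
    Separable (node a x y) (node a x′ y′) h
  separable-node {h} {a} {v} {x} {y} {x′} {y′} admissible (f , o , differ) =
    override f h (λ _ → v) , o , λ e → differ (begin
      observe f (if v then x else y) ((a , v) ∷ h) o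
        ≡⟨ observe-override-node f h a v x y admissible o ⟨
      observe (override f h λ _ → v) (node a x y) h o
        ≡⟨ e ⟩
      observe (override f h λ _ → v) (node a x′ y′) h o
        ≡⟨ observe-override-node f h a v x′ y′ admissible o ⟩
      observe f (if v then x′ else y′) ((a , v) ∷ h) o ∎)

  module _ (another : Fin n → Fin n) (another-≢ : ∀ a → another a ≢ a) where

    distinct-replies : ∀ f {g h} → g ≢ h → length g ≤ length h →
      let steered = override f h (not ∘ reply f g) in
      ∃[ b ] reply steered g b ≢ reply steered h b
    distinct-replies f {[]} {[]} g≢h _ = ⊥-elim (g≢h refl)
    distinct-replies f {g} {h@((d , w) ∷ t)} g≢h _ = another d , λ e →
      not-¬ (reply-cong g (override-elsewhere f φ g≢h) (another d)) (begin
        reply (override f h φ) g (another d)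
          ≡⟨ e ⟩
        reply (override f h φ) h (another d)
          ≡⟨ reply-untested (override f h φ) t (another-≢ d ∘ Eq.sym) ⟩
        override f h φ h (another d)
          ≡⟨ Eq.cong-app (override-at f h φ) (another d) ⟩
        φ (another d) ∎)
      where
        φ : Fin n → Bool
        φ = not ∘ reply f g

    separable-by-longer : ∀ f N M h → final f N h ≢ final f M h →
      length (final f N h) ≤ length (final f M h) → Separable N M h
    separable-by-longer f N M h N≢M N≤M with distinct-replies f N≢M N≤M
    ... | b , differ = steered , just b , λ e → differ (begin
      reply steered (final f N h) b        ≡⟨ Eq.cong (replyAfter ∘ proj₂) runN ⟨
      reply steered (final steered N h) b  ≡⟨ e ⟩
      reply steered (final steered M h) b  ≡⟨ Eq.cong (replyAfter ∘ proj₂) runM ⟩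
      reply steered (final f M h) b        ∎)
      where
        steered : Oracle
        steered = override f (final f M h) (not ∘ reply f (final f N h))
        replyAfter : History → Bool
        replyAfter g = reply steered g b
        runN : run steered N h ≡ run f N h
        runN = frame f steered N h λ g _ g<N →
          override-elsewhere f _ (shorter-≢ (<-≤-trans g<N N≤M))
        runM : run steered M h ≡ run f M h
        runM = frame f steered M h λ g _ g<M → override-elsewhere f _ (shorter-≢ g<M)

    separable-by-final : ∀ f N M h → final f N h ≢ final f M h → Separable N M h
    separable-by-final f N M h N≢M
      with ≤-total (length (final f N h)) (length (final f M h))
    ... | inj₁ N≤M = separable-by-longer f N M h N≢M N≤M
    ... | inj₂ M≤N = separable-sym (separable-by-longer f M N h (N≢M ∘ Eq.sym) M≤N)

    separable-leaf-node : ∀ f v a x y h → Separable (leaf v) (node a x y) h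
    separable-leaf-node f v a x y h =
      separable-by-final f (leaf v) (node a x y) h (shorter-≢ (node-longer f a x y h))

    separable-first-tests : ∀ f h → a ≢ b → Separable (node a x y) (node b x′ y′) h
    separable-first-tests {a} {b} {x} {y} {x′} {y′} f h a≢b =
      separable-by-final f (node a x y) (node b x′ y′) h first-tests-≢
      where
        first-tests-≢ : final f (node a x y) h ≢ final f (node b x′ y′) h
        first-tests-≢ e with final-node f a x y h | final-node f b x′ y′ h
        ... | X , eX | Y , eY =
          a≢b (Eq.cong proj₁ (++-∷-cancelʳ X Y h (Eq.trans (Eq.sym eX) (Eq.trans e eY))))

    anyOracle : Oracle
    anyOracle _ _ = true

    mutual
      separate : Normal c N → Normal c M → ∀ h → head h ≡ c →
        N ≡ M ⊎ Separable N M h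
      separate (leaf {v = v}) (leaf {v = w}) h _ with v ≟ᵇ w
      ... | yes refl = inj₁ refl
      ... | no v≢w = inj₂ (anyOracle , nothing , v≢w)
      separate leaf (node _) h _ = inj₂ (separable-leaf-node anyOracle _ _ _ _ h)
      separate (node _) leaf h _ = inj₂ (separable-sym (separable-leaf-node anyOracle _ _ _ _ h))
      separate (node {a = a} nN) (node {a = b} nM) h last with a ≟ b
      ... | no a≢b = inj₂ (separable-first-tests anyOracle h a≢b)
      ... | yes refl = separate-nodes nN nM h last

      separate-nodes : NormalNode c a x y → NormalNode c a x′ y′ →
        ∀ h → head h ≡ c →
        node a x y ≡ node a x′ y′ ⊎ Separable (node a x y) (node a x′ y′) h
      separate-nodes (repeated nx) (repeated nx′) h last
        with separate nx nx′ (_ ∷ h) refl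
      ... | inj₁ refl = inj₁ refl
      ... | inj₂ sep = inj₂ (separable-node admissible
        (Eq.subst₂ (λ N M → Separable N M _) (Eq.sym (if-eta _)) (Eq.sym (if-eta _)) sep))
        where
          admissible : Admissible h _ _
          admissible w e = Eq.cong proj₂ (just-injective (Eq.trans (Eq.sym e) last))
      separate-nodes (repeated _) (fresh new _ _) h last = ⊥-elim (new _ refl)
      separate-nodes (fresh new _ _) (repeated _) h last = ⊥-elim (new _ refl)
      separate-nodes (fresh new nx ny) (fresh _ nx′ ny′) h last
        with separate nx nx′ (_ ∷ h) refl | separate ny ny′ (_ ∷ h) refl
      ... | inj₂ sep | _ = inj₂ (separable-node admissible sep)
        where
          admissible : Admissible h _ true
          admissible w e = ⊥-elim (new w (Eq.trans (Eq.sym last) e))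
      ... | inj₁ refl | inj₂ sep = inj₂ (separable-node admissible sep)
        where
          admissible : Admissible h _ false
          admissible w e = ⊥-elim (new w (Eq.trans (Eq.sym last) e))
      ... | inj₁ refl | inj₁ refl = inj₁ refl

    observable : Maybe (Fin n) → CTerm n → CTerm n
    observable nothing P = P
    observable (just b) P = atom b ◁ P ▷ atom b

    reaction-sound : ∀ f {P} N → CPrp⊢ embed P ≈ ⌜ N ⌝ → ∀ h →
      Soundness.reaction (historyRVA f) P (after h)
        ≡ (proj₁ (run f N h) , after (final f N h))
    reaction-sound f N P≈N h =
      Eq.trans (sound-closed (historyRVA-rp f) {Q = toTerm N} P≈N (after h)) (run-sound f N h)
      where open Soundness (historyRVA f)

    observe-sound : ∀ f {P} N → CPrp⊢ embed P ≈ ⌜ N ⌝ → ∀ h o →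
      _/_ (historyRVA f) (observable o P) (after h) ≡ observe f N h o
    observe-sound f N P≈N h nothing = Eq.cong proj₁ (reaction-sound f N P≈N h)
    observe-sound f N P≈N h (just b) =
      Eq.trans (if-eta _) (Eq.cong (answer f b ∘ proj₂) (reaction-sound f N P≈N h))

    complete : (P Q : CTerm n) → P =rp Q → CPrp⊢ embed P ≈ embed Q
    complete P Q (R , isCongruence , R⊆≡rp , PRQ) with normalForm P | normalForm Q
    ... | N , nN , P≈N | M , nM , Q≈M with separate nN nM [] refl
    ...   | inj₁ refl = trans P≈N (sym Q≈M)
    ...   | inj₂ (f , o , differ) = ⊥-elim (differ (begin
      observe f N [] o                                  ≡⟨ observe-sound f N P≈N [] o ⟨
      _/_ (historyRVA f) (observable o P) (after [])
        ≡⟨ R⊆≡rp (observable-related o) (historyRVA f) (historyRVA-rp f) (after []) ⟩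
      _/_ (historyRVA f) (observable o Q) (after [])    ≡⟨ observe-sound f M Q≈M [] o ⟩
      observe f M [] o                                  ∎))
      where
        open IsCongruence isCongruence
        observable-related : ∀ o → R (observable o P) (observable o Q)
        observable-related nothing = PRQ
        observable-related (just b) = compatible reflexive PRQ reflexive

mainTheorem6 : (n : ℕ) → 2 ≤ n → (P Q : CTerm n) →
    P =rp Q → CPrp⊢ embed P ≈ embed Q
mainTheorem6 (suc (suc m)) (s≤s (s≤s z≤n)) = complete another another-≢
  where
    another : Fin (suc (suc m)) → Fin (suc (suc m))
    another zero = suc zero
    another (suc _) = zero

    another-≢ : ∀ a → another a ≢ a
    another-≢ zero ()
    another-≢ (suc _) ()
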